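{- Let $f:\mathcal C\to\mathcal D$ be a surjective morphism of neural codes, and let $g:\widehat{\mathcal C}\to\widehat{\mathcal D}$ be the unique surjective morphism with $g(c)=f(c)$ for all $c\in\mathcal C$. Then $\widehat{\mathcal C}$ covers $\widehat{\mathcal D}$ in $\mathbf{P}_{\mathbf{Code}}$ if and only if $\mathcal C$ covers $\mathcal D$ in $\mathbf{P}_{\mathbf{Code}}$.
   Context: A neural code is a set $\mathcal C\subseteq 2^{[n]}$ containing $\varnothing$. For $\sigma\subseteq[n]$, the trunk $\mathrm{Tk}_{\mathcal C}(\sigma)=\{\tau\in\mathcal C:\sigma\subseteq\tau\}$; a trunk is proper if nonempty and not equal to $\mathcal C$. A morphism $f:\mathcal C\to\mathcal D$ is a function such that the preimage of every proper trunk in $\mathcal D$ is a proper trunk in $\mathcal C$; an isomorphism is a bijective morphism whose inverse is a morphism. Write $\mathcal D\le\mathcal C$ if there is a surjective morphism $\mathcal C\to\mathcal D$; this is a partial order on isomorphism classes of neural codes, called $\mathbf{P}_{\mathbf{Code}}$. $\mathcal C$ covers $\mathcal D$ if $\mathcal D<\mathcal C$ in $\mathbf{P}_{\mathbf{Code}}$ and there is no code $\mathcal E$ with $\mathcal D<\mathcal E<\mathcal C$. A code is intersection-complete if it is closed under pairwise intersection; the intersection-completion $\widehat{\mathcal C}$ is the set of all intersections of nonempty subfamilies of $\mathcal C$. (For any morphism $f:\mathcal C\to\mathcal D$ there is a unique morphism $g:\widehat{\mathcal C}\to\widehat{\mathcal D}$ extending $f$, and it is surjective if $f$ is.) -}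

module Defs where

open import Data.Nat using (ℕ)
open import Data.Fin.Subset using (Subset; _⊆_; _∩_) renaming (⊥ to ∅)
open import Data.List using (List; foldr)
open import Data.List.Relation.Unary.All using (All; [])
open import Data.Product using (Σ; ∃; ∃-syntax; _×_; _,_)
open import Relation.Nullary using (¬_)
open import Relation.Binary.PropositionalEquality using (_≡_; refl)
open import Function.Bundles using (_⇔_)

record Code : Set₁ where
  field
    n        : ℕ
    mem      : Subset n → Set
    hasEmpty : mem ∅
open Code public

IsTrunk : (C : Code) → (Subset (n C) → Set) → Set
IsTrunk C S = ∃[ τ ] (∀ c → mem C c → (S c ⇔ τ ⊆ c))

IsProperTrunk : (C : Code) → (Subset (n C) → Set) → Set
IsProperTrunk C S =
  IsTrunk C S × (∃[ c ] (mem C c × S c)) × ¬ (∀ c → mem C c → S c)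

-- Maps between codes are represented by functions on subsets; only their
-- values on codewords matter.
Map : Code → Code → Set
Map C D = Subset (n C) → Subset (n D)

IsMorphism : (C D : Code) → Map C D → Set₁
IsMorphism C D f =
  (∀ c → mem C c → mem D (f c)) ×
  (∀ (S : Subset (n D) → Set) → IsProperTrunk D S →
     IsProperTrunk C (λ c → S (f c)))

IsSurjective : (C D : Code) → Map C D → Set
IsSurjective C D f = ∀ d → mem D d → ∃[ c ] (mem C c × f c ≡ d)

Iso : Code → Code → Set₁
Iso C D = Σ (Map C D) λ f → Σ (Map D C) λ h →
  IsMorphism C D f × IsMorphism D C h ×
  (∀ c → mem C c → h (f c) ≡ c) × (∀ d → mem D d → f (h d) ≡ d)

_≤C_ : Code → Code → Set₁
D ≤C C = Σ (Map C D) λ f → IsMorphism C D f × IsSurjective C D f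

_<C_ : Code → Code → Set₁
D <C C = (D ≤C C) × ¬ Iso D C

Covers : Code → Code → Set₁
Covers C D = (D <C C) × (∀ (E : Code) → ¬ ((D <C E) × (E <C C)))

⋂ : ∀ {k} → Subset k → List (Subset k) → Subset k
⋂ c cs = foldr _∩_ c cs

-- Intersection-completion: all intersections of nonempty subfamilies of C
-- (C is finite, so subfamilies are finite and listed as c ∷ cs).
hat : Code → Code
hat C = record
  { n = n C
  ; mem = λ σ → Σ (Subset (n C)) λ c → Σ (List (Subset (n C))) λ cs →
             mem C c × All (mem C) cs × ⋂ c cs ≡ σ
  ; hasEmpty = ∅ , Data.List.[] , hasEmpty C , [] , refl
  }

-- A surjective morphism f : X → Y pulls each trunk Tk_Y(σ) back to the trunk Tk_X(pull σ), where
-- pull σ is the intersection of the codewords c with σ ⊆ f c. Elements of an intersection-complete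
-- code are determined by their trunks, so pull is injective on hat Y and rank X = |hat X| is
-- monotone; when pull is onto, f is injective with a morphism as inverse, so rank is strictly
-- monotone along <. If pull misses at least two elements of hat X, pick a missed t maximal for ⊆
-- and add to Y one neuron recording t ⊆ c: the code {(t ⊆ c) ∷ f c} lies strictly between Y and X.
-- Hence X covers Y exactly when rank X = 1 + rank Y, and rank (hat X) = rank X.
-- Code membership need not be decidable, but apart from the given morphisms Covers is a negation,
-- so decidability may be assumed under a double negation.

module Submission where

open import Defs
open import Data.Bool using (Bool; true; false)
import Data.Bool.Properties as Bool
open import Data.Empty using (⊥-elim)
open import Data.Fin.Subset using (Subset; _⊆_; _⊃_; _∈_; _∪_; ⊤; ⁅_⁆; inside; outside) renaming (⊥ to ∅)
open import Data.Fin.Subset.Induction using (⊃-wellFounded)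
open import Data.Fin.Subset.Properties using (anySubset?; _⊆?_; _⊂?_; _∈?_; ⊆-refl; ⊆-trans; ⊆-antisym; ⊆-min; ⊆⊤; x∈⁅x⁆; x∈⁅y⁆⇒x≡y; p∩q⊆p; p∩q⊆q; x∈p∩q⁺; p⊆p∪q; q⊆p∪q; x∈p∪q⁻; out⊆; out⊆-⇔; in⊆in; drop-∷-⊆)
open import Data.List using (List; []; _∷_; _++_; map; filter; length)
open import Data.List.Properties using (length-map; length-removeAt′)
open import Data.List.Membership.Propositional using (_─_) renaming (_∈_ to _∈ₗ_)
open import Data.List.Membership.Propositional.Properties using (∈-map⁺; ∈-map⁻; ∈-++⁺ˡ; ∈-++⁺ʳ; ∈-filter⁺; ∈-filter⁻)
open import Data.List.Relation.Unary.All as All using (All; []; _∷_)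
import Data.List.Relation.Unary.All.Properties as All
open import Data.List.Relation.Unary.AllPairs using ([]; _∷_)
open import Data.List.Relation.Unary.Any using (here; there; index)
open import Data.List.Relation.Unary.Unique.Propositional using (Unique)
import Data.List.Relation.Unary.Unique.Propositional.Properties as Unique
open import Data.Nat using (ℕ; zero; suc; _+_; _≤_; _<_; _≤?_; s≤s; z≤n)
open import Data.Nat.Properties using (≤-trans; ≤-antisym; ≤-reflexive; ≤-pred; 1+n≰n; <⇒≱; ≤∧≢⇒<; ≰⇒>; module ≤-Reasoning)
open import Data.Product using (∃-syntax; _×_; _,_; proj₁; proj₂)
open import Data.Product.Function.NonDependent.Propositional using (_×-⇔_)
open import Data.Sum using ([_,_]′)
open import Data.Vec using ([]; _∷_; tail; here)
open import Data.Vec.Properties using (∷-injectiveʳ)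
import Data.Vec.Properties as Vec
open import Effect.Monad using (RawMonad)
open import Function.Base using (flip)
open import Function.Bundles using (_⇔_; mk⇔; Equivalence)
open import Function.Construct.Composition using (_⇔-∘_)
open import Function.Construct.Identity using (⇔-id)
open import Function.Construct.Symmetry using (⇔-sym)
open import Function.Properties.Equivalence using (⇔-setoid)
open import Function.Related.Propositional using (module EquationalReasoning)
open import Induction.WellFounded using (Acc; acc)
open import Level using (0ℓ)
import Relation.Binary.Reasoning.Setoid as SetoidReasoning
open import Relation.Binary.PropositionalEquality using (_≡_; _≢_; refl; sym; trans; cong; cong₂; subst)
open import Relation.Nullary using (¬_; Dec; yes; no; does; contradiction; ¬?; _×-dec_)
open import Relation.Nullary.Decidable using (map′; decidable-stable; ¬¬-excluded-middle)
open import Relation.Nullary.Negation using (¬¬-Monad; ¬¬-map)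
open import Relation.Unary using (Pred; Decidable)

private
  variable
    k m : ℕ
    τ a : Subset k
    cs : List (Subset k)

_≟_ : (σ τ : Subset k) → Dec (σ ≡ τ)
_≟_ = Vec.≡-dec Bool._≟_

subsets : ∀ k → List (Subset k)
subsets zero    = [] ∷ []
subsets (suc k) = map (inside ∷_) (subsets k) ++ map (outside ∷_) (subsets k)

∈-subsets : (σ : Subset k) → σ ∈ₗ subsets k
∈-subsets []            = here refl
∈-subsets (inside ∷ σ)  = ∈-++⁺ˡ (∈-map⁺ (inside ∷_) (∈-subsets σ))
∈-subsets (outside ∷ σ) = ∈-++⁺ʳ _ (∈-map⁺ (outside ∷_) (∈-subsets σ))

subsets-unique : ∀ k → Unique (subsets k)
subsets-unique zero    = [] ∷ []
subsets-unique (suc k) = Unique.++⁺ (Unique.map⁺ ∷-injectiveʳ (subsets-unique k))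
                                    (Unique.map⁺ ∷-injectiveʳ (subsets-unique k)) disjoint
  where
  disjoint : ∀ {σ} → ¬ (σ ∈ₗ map (inside ∷_) (subsets k) × σ ∈ₗ map (outside ∷_) (subsets k))
  disjoint (p , q) with ∈-map⁻ _ p | ∈-map⁻ _ q
  ... | _ , _ , refl | _ , _ , ()

∈-─⁺ : ∀ {A : Set} {x z : A} {ys} (x∈ys : x ∈ₗ ys) → z ∈ₗ ys → z ≢ x → z ∈ₗ ys ─ x∈ys
∈-─⁺ (here refl) (here refl) z≢x = contradiction refl z≢x
∈-─⁺ (here _)    (there z∈)  _   = z∈
∈-─⁺ (there _)   (here refl) _   = here refl
∈-─⁺ (there x∈)  (there z∈)  z≢x = there (∈-─⁺ x∈ z∈ z≢x)

unique-⊆⇒length-≤ : ∀ {A : Set} {xs ys : List A} → Unique xs → (∀ {z} → z ∈ₗ xs → z ∈ₗ ys) →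
                    length xs ≤ length ys
unique-⊆⇒length-≤ {xs = []}          _                  _     = z≤n
unique-⊆⇒length-≤ {xs = x ∷ xs} {ys} (x≢xs ∷ xs-unique) xs⊆ys = begin
  suc (length xs)          ≤⟨ s≤s (unique-⊆⇒length-≤ xs-unique z∈xs⇒z∈ys─x) ⟩
  suc (length (ys ─ x∈ys)) ≡⟨ sym (length-removeAt′ ys (index x∈ys)) ⟩
  length ys                ∎
  where
  open ≤-Reasoning
  x∈ys : x ∈ₗ ys
  x∈ys = xs⊆ys (here refl)
  z∈xs⇒z∈ys─x : ∀ {z} → z ∈ₗ xs → z ∈ₗ ys ─ x∈ys
  z∈xs⇒z∈ys─x z∈xs = ∈-─⁺ x∈ys (xs⊆ys (there z∈xs)) (λ z≡x → All.lookup x≢xs z∈xs (sym z≡x))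

module _ {P : Pred (Subset k) 0ℓ} (P? : Decidable P) where

  elements : List (Subset k)
  elements = filter P? (subsets k)

  size : ℕ
  size = length elements

  elements-unique : Unique elements
  elements-unique = Unique.filter⁺ P? (subsets-unique k)

  ∈-elements⁺ : ∀ {σ} → P σ → σ ∈ₗ elements
  ∈-elements⁺ {σ} = ∈-filter⁺ P? (∈-subsets σ)

  ∈-elements⁻ : ∀ {σ} → σ ∈ₗ elements → P σ
  ∈-elements⁻ σ∈ = proj₂ (∈-filter⁻ P? {xs = subsets k} σ∈)

size-mono : {P Q : Pred (Subset k) 0ℓ} (P? : Decidable P) (Q? : Decidable Q) →
            (∀ {σ} → P σ → Q σ) → size P? ≤ size Q?
size-mono P? Q? P⇒Q = unique-⊆⇒length-≤ (elements-unique P?)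
  (λ σ∈ → ∈-elements⁺ Q? (P⇒Q (∈-elements⁻ P? σ∈)))

map⁺-injectiveOn : ∀ {A B : Set} {P : A → Set} {f : A → B} {xs} →
                   (∀ {x y} → P x → P y → f x ≡ f y → x ≡ y) →
                   All P xs → Unique xs → Unique (map f xs)
map⁺-injectiveOn inj []         []                 = []
map⁺-injectiveOn inj (px ∷ pxs) (x≢xs ∷ xs-unique) =
  All.map⁺ (All.zipWith (λ (py , x≢y) fx≡fy → x≢y (inj px py fx≡fy)) (pxs , x≢xs))
  ∷ map⁺-injectiveOn inj pxs xs-unique

module InjectionOn {P : Pred (Subset k) 0ℓ} {Q : Pred (Subset m) 0ℓ}
  (P? : Decidable P) (Q? : Decidable Q) (F : Subset k → Subset m)
  (F-maps : ∀ {σ} → P σ → Q (F σ))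
  (F-injective : ∀ {σ σ′} → P σ → P σ′ → F σ ≡ F σ′ → σ ≡ σ′) where

  Hit : Pred (Subset m) 0ℓ
  Hit b = ∃[ σ ] P σ × F σ ≡ b

  Missed : Pred (Subset m) 0ℓ
  Missed b = Q b × ¬ Hit b

  hit? : Decidable Hit
  hit? b = anySubset? (λ σ → P? σ ×-dec (F σ ≟ b))

  missed? : Decidable Missed
  missed? b = Q? b ×-dec ¬? (hit? b)

  private
    image : List (Subset m)
    image = map F (elements P?)

    length-image : length image ≡ size P?
    length-image = length-map F (elements P?)

    image-unique : Unique image
    image-unique = map⁺-injectiveOn F-injective (All.tabulate (∈-elements⁻ P?)) (elements-unique P?)

    ∈-image : ∀ {b} → Hit b → b ∈ₗ image
    ∈-image (σ , Pσ , refl) = ∈-map⁺ F (∈-elements⁺ P? Pσ)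

    image⊆Q : ∀ {b} → b ∈ₗ image → b ∈ₗ elements Q?
    image⊆Q b∈ with ∈-map⁻ F b∈
    ... | σ , σ∈ , refl = ∈-elements⁺ Q? (F-maps (∈-elements⁻ P? σ∈))

  size-≤ : size P? ≤ size Q?
  size-≤ = subst (_≤ size Q?) length-image (unique-⊆⇒length-≤ image-unique image⊆Q)

  missed⇒size-< : ∀ {b} → Missed b → size P? < size Q?
  missed⇒size-< {b} (Qb , ¬hit) = subst (λ l → suc l ≤ size Q?) length-image
    (unique-⊆⇒length-≤ (All.tabulate b∉image ∷ image-unique) b∷image⊆Q)
    where
    b∉image : ∀ {b′} → b′ ∈ₗ image → b ≢ b′
    b∉image b′∈ refl with ∈-map⁻ F b′∈
    ... | σ , σ∈ , refl = ¬hit (σ , ∈-elements⁻ P? σ∈ , refl)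
    b∷image⊆Q : ∀ {b′} → b′ ∈ₗ b ∷ image → b′ ∈ₗ elements Q?
    b∷image⊆Q (here refl) = ∈-elements⁺ Q? Qb
    b∷image⊆Q (there b′∈) = image⊆Q b′∈

  size-≥⇒onto : size Q? ≤ size P? → ∀ {b} → Q b → Hit b
  size-≥⇒onto Q≤P {b} Qb = decidable-stable (hit? b)
    (λ ¬hit → 1+n≰n (≤-trans (missed⇒size-< (Qb , ¬hit)) Q≤P))

  two-more⇒missed-besides : 2 + size P? ≤ size Q? → ∀ b → ∃[ b′ ] Missed b′ × b′ ≢ b
  two-more⇒missed-besides 2+P≤Q b = decidable-stable (anySubset? (λ b′ → missed? b′ ×-dec ¬? (b′ ≟ b)))
    (λ none → 1+n≰n (≤-trans 2+P≤Q (subst (λ l → size Q? ≤ suc l) length-image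
      (unique-⊆⇒length-≤ (elements-unique Q?) (λ b′∈ → covered none (∈-elements⁻ Q? b′∈))))))
    where
    covered : ¬ (∃[ b′ ] Missed b′ × b′ ≢ b) → ∀ {b′} → Q b′ → b′ ∈ₗ b ∷ image
    covered none {b′} Qb′ with b′ ≟ b | hit? b′
    ... | yes refl | _       = here refl
    ... | no _     | yes hit = there (∈-image hit)
    ... | no b′≢b  | no ¬hit = contradiction (b′ , (Qb′ , ¬hit) , b′≢b) none

maximal : {Q : Pred (Subset k) 0ℓ} → Decidable Q → ∀ {t} → Q t →
          ∃[ u ] Q u × (∀ {u′} → Q u′ → u ⊆ u′ → u′ ≡ u)
maximal {Q = Q} Q? {t} Qt = go Qt (⊃-wellFounded t)
  where
  go : ∀ {t} → Q t → Acc _⊃_ t → ∃[ u ] Q u × (∀ {u′} → Q u′ → u ⊆ u′ → u′ ≡ u)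
  go {t} Qt (acc rs) with anySubset? (λ u → Q? u ×-dec (t ⊂? u))
  ... | yes (u , Qu , t⊂u) = go Qu (rs t⊂u)
  ... | no ∄ = t , Qt , λ {u′} Qu′ t⊆u′ → ⊆-antisym
        (λ {x} x∈u′ → decidable-stable (x ∈? t) (λ x∉t → ∄ (u′ , Qu′ , t⊆u′ , x , x∈u′ , x∉t)))
        t⊆u′

¬¬-decidable : (P : Pred (Subset k) 0ℓ) → ¬ ¬ Decidable P
¬¬-decidable {zero}  P = (λ P[]? → λ { [] → P[]? }) <$> ¬¬-excluded-middle
  where open RawMonad ¬¬-Monad
¬¬-decidable {suc k} P = do
  P-inside?  ← ¬¬-decidable (λ σ → P (inside ∷ σ))
  P-outside? ← ¬¬-decidable (λ σ → P (outside ∷ σ))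
  pure λ { (inside ∷ σ) → P-inside? σ ; (outside ∷ σ) → P-outside? σ }
  where open RawMonad ¬¬-Monad

⋂-greatest : τ ⊆ a → All (τ ⊆_) cs → τ ⊆ ⋂ a cs
⋂-greatest τ⊆a []            = τ⊆a
⋂-greatest τ⊆a (τ⊆c ∷ τ⊆cs) = λ x∈τ → x∈p∩q⁺ (τ⊆c x∈τ , ⋂-greatest τ⊆a τ⊆cs x∈τ)

⋂-lowerˡ : ∀ cs → ⋂ a cs ⊆ a
⋂-lowerˡ []       = ⊆-refl
⋂-lowerˡ (c ∷ cs) = ⊆-trans (p∩q⊆q c _) (⋂-lowerˡ cs)

⋂-lowerʳ : ∀ cs → All (⋂ a cs ⊆_) cs
⋂-lowerʳ []       = []
⋂-lowerʳ (c ∷ cs) = p∩q⊆p c _ ∷ All.map (⊆-trans (p∩q⊆q c _)) (⋂-lowerʳ cs)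

module Closure (X : Code) (X? : Decidable (mem X)) where

  Bounded : Pred (Subset (n X)) 0ℓ
  Bounded τ = ∃[ c ] mem X c × τ ⊆ c

  module _ {S : Pred (Subset (n X)) 0ℓ} (S? : Decidable S) where

    X∧S? : Decidable (λ c → mem X c × S c)
    X∧S? c = X? c ×-dec S? c

    family : List (Subset (n X))
    family = elements X∧S?

    -- ⋂[ S? ] = ⊤ when no codeword satisfies S.
    ⋂[_] : Subset (n X)
    ⋂[_] = ⋂ ⊤ family

    ⋂[]-lower : ∀ {c} → mem X c → S c → ⋂[_] ⊆ c
    ⋂[]-lower mc Sc = All.lookup (⋂-lowerʳ family) (∈-elements⁺ X∧S? (mc , Sc))

    ⋂[]-greatest : (∀ {c} → mem X c → S c → τ ⊆ c) → τ ⊆ ⋂[_]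
    ⋂[]-greatest τ⊆S = ⋂-greatest ⊆⊤ (All.tabulate (λ c∈ → let mc , Sc = ∈-elements⁻ X∧S? c∈ in τ⊆S mc Sc))

    trunk-⋂ : IsTrunk X S → ∀ {c} → mem X c → S c ⇔ ⋂[_] ⊆ c
    trunk-⋂ (τ , S⇔τ⊆) mc = mk⇔ (⋂[]-lower mc)
      (λ ⋂⊆c → Equivalence.from (S⇔τ⊆ _ mc)
        (⊆-trans (⋂[]-greatest (λ mc′ Sc′ → Equivalence.to (S⇔τ⊆ _ mc′) Sc′)) ⋂⊆c))

  cl : Subset (n X) → Subset (n X)
  cl τ = ⋂[ τ ⊆?_ ]

  ⊆-cl : τ ⊆ cl τ
  ⊆-cl {τ = τ} = ⋂[]-greatest (τ ⊆?_) (λ _ τ⊆c → τ⊆c)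

  cl-⊆ : ∀ {c} → mem X c → τ ⊆ c → cl τ ⊆ c
  cl-⊆ {τ = τ} = ⋂[]-lower (τ ⊆?_)

  ⊆⇔cl-⊆ : ∀ {c} → mem X c → τ ⊆ c ⇔ cl τ ⊆ c
  ⊆⇔cl-⊆ {τ = τ} = trunk-⋂ (τ ⊆?_) (τ , λ c _ → ⇔-id (τ ⊆ c))

  ⋂[]∈hat : {S : Pred (Subset (n X)) 0ℓ} (S? : Decidable S) → ∀ {c} → mem X c → S c → mem (hat X) ⋂[ S? ]
  ⋂[]∈hat S? {c} mc Sc = c , family S? , mc , All.tabulate (λ c∈ → proj₁ (∈-elements⁻ (X∧S? S?) c∈)) ,
    ⊆-antisym (⋂-greatest ⊆⊤ (⋂-lowerʳ (family S?))) (⋂-greatest (⋂[]-lower S? mc Sc) (⋂-lowerʳ (family S?)))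

  codeword∈hat : ∀ {c} → mem X c → mem (hat X) c
  codeword∈hat {c} mc = c , [] , mc , [] , refl

  hat⁻ : ∀ {σ} → mem (hat X) σ → Bounded σ × cl σ ⊆ σ
  hat⁻ (c , cs , mc , mcs , refl) = (c , mc , ⋂-lowerˡ cs) ,
    ⋂-greatest (cl-⊆ mc (⋂-lowerˡ cs)) (All.tabulate (λ d∈ → cl-⊆ (All.lookup mcs d∈) (All.lookup (⋂-lowerʳ cs) d∈)))

  hat⁺ : ∀ {σ} → Bounded σ → cl σ ⊆ σ → mem (hat X) σ
  hat⁺ {σ} (c , mc , σ⊆c) clσ⊆σ = subst (mem (hat X)) (⊆-antisym clσ⊆σ ⊆-cl) (⋂[]∈hat (σ ⊆?_) mc σ⊆c)

  hat? : Decidable (mem (hat X))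
  hat? σ = map′ (λ (b , clσ⊆σ) → hat⁺ b clσ⊆σ) hat⁻
                (anySubset? (λ c → X? c ×-dec σ ⊆? c) ×-dec cl σ ⊆? σ)

  Tk⊆Tk⇒⊇ : ∀ {a b} → mem (hat X) a → (∀ {c} → mem X c → a ⊆ c → b ⊆ c) → b ⊆ a
  Tk⊆Tk⇒⊇ {a} ha Tka⊆Tkb = ⊆-trans (⋂[]-greatest (a ⊆?_) Tka⊆Tkb) (proj₂ (hat⁻ ha))

  Tk≡Tk⇒≡ : ∀ {a b} → mem (hat X) a → mem (hat X) b → (∀ {c} → mem X c → a ⊆ c ⇔ b ⊆ c) → a ≡ b
  Tk≡Tk⇒≡ ha hb Tka≡Tkb = ⊆-antisym (Tk⊆Tk⇒⊇ hb (λ mc → Equivalence.from (Tka≡Tkb mc)))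
                                     (Tk⊆Tk⇒⊇ ha (λ mc → Equivalence.to (Tka≡Tkb mc)))

  rank : ℕ
  rank = size hat?

open Closure using (rank)

hat-idempotent : ∀ {X} (X? : Decidable (mem X)) {σ} → mem (hat (hat X)) σ → mem (hat X) σ
hat-idempotent {X} X? {σ} hhσ =
  let (e , he , σ⊆e) , ĉlσ⊆σ = Ĉ.hat⁻ hhσ
      (c , mc , e⊆c) = proj₁ (C.hat⁻ he)
  in C.hat⁺ (c , mc , ⊆-trans σ⊆e e⊆c)
       (⊆-trans (Ĉ.⋂[]-greatest (σ ⊆?_) (λ he′ σ⊆e′ → C.Tk⊆Tk⇒⊇ he′ (λ mc′ e′⊆c′ → C.cl-⊆ mc′ (⊆-trans σ⊆e′ e′⊆c′))))
                ĉlσ⊆σ)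
  where
  module C = Closure X X?
  module Ĉ = Closure (hat X) C.hat?

rank-hat : ∀ {X} (X? : Decidable (mem X)) → rank (hat X) (Closure.hat? X X?) ≡ rank X X?
rank-hat {X} X? = ≤-antisym (size-mono Ĉ.hat? C.hat? (hat-idempotent {X} X?)) (size-mono C.hat? Ĉ.hat? Ĉ.codeword∈hat)
  where
  module C = Closure X X?
  module Ĉ = Closure (hat X) C.hat?

module Pullback (X Y : Code) (X? : Decidable (mem X)) (Y? : Decidable (mem Y))
  {f : Map X Y} (f-morphism : IsMorphism X Y f) (f-surjective : IsSurjective X Y f) where

  module CX = Closure X X?
  module CY = Closure Y Y?

  pull : Subset (n Y) → Subset (n X)
  pull σ = CX.⋂[ (λ c → σ ⊆? f c) ]

  private
    variable
      σ σ′ : Subset (n Y)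
      c c′ : Subset (n X)

  lift-bound : CY.Bounded σ → ∃[ c ] mem X c × σ ⊆ f c
  lift-bound (d , md , σ⊆d) with f-surjective d md
  ... | c , mc , refl = c , mc , σ⊆d

  preimage-trunk : CY.Bounded σ → IsTrunk X (λ c → σ ⊆ f c)
  preimage-trunk {σ} (d , md , σ⊆d) with σ ≟ ∅
  ... | yes refl = ∅ , λ c _ → mk⇔ {A = ∅ ⊆ f c} {B = ∅ ⊆ c} (λ _ → ⊆-min c) (λ _ → ⊆-min (f c))
  ... | no σ≢∅   = proj₁ (proj₂ f-morphism (σ ⊆_) Tk-proper)
    where
    Tk-proper : IsProperTrunk Y (σ ⊆_)
    Tk-proper = (σ , λ d _ → ⇔-id (σ ⊆ d)) , (d , md , σ⊆d) ,
                λ all → σ≢∅ (⊆-antisym (all ∅ (hasEmpty Y)) (⊆-min σ))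

  ⊆f⇔pull-⊆ : CY.Bounded σ → mem X c → σ ⊆ f c ⇔ pull σ ⊆ c
  ⊆f⇔pull-⊆ {σ} bσ = CX.trunk-⋂ (λ c → σ ⊆? f c) (preimage-trunk bσ)

  pull∈hat : CY.Bounded σ → mem (hat X) (pull σ)
  pull∈hat {σ} bσ = let c , mc , σ⊆fc = lift-bound bσ in CX.⋂[]∈hat (λ c → σ ⊆? f c) mc σ⊆fc

  pull-injective : mem (hat Y) σ → mem (hat Y) σ′ → pull σ ≡ pull σ′ → σ ≡ σ′
  pull-injective {σ} {σ′} hσ hσ′ pullσ≡pullσ′ = CY.Tk≡Tk⇒≡ hσ hσ′ Tkσ≡Tkσ′
    where
    Tkσ≡Tkσ′ : ∀ {d} → mem Y d → σ ⊆ d ⇔ σ′ ⊆ d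
    Tkσ≡Tkσ′ {d} md with f-surjective d md
    ... | c , mc , refl = begin
      σ ⊆ f c    ≈⟨ ⊆f⇔pull-⊆ (proj₁ (CY.hat⁻ hσ)) mc ⟩
      pull σ ⊆ c  ≡⟨ cong (_⊆ c) pullσ≡pullσ′ ⟩
      pull σ′ ⊆ c ≈⟨ ⊆f⇔pull-⊆ (proj₁ (CY.hat⁻ hσ′)) mc ⟨
      σ′ ⊆ f c   ∎
      where open SetoidReasoning (⇔-setoid 0ℓ)

  pull-∅ : pull ∅ ≡ ∅
  pull-∅ = ⊆-antisym (CX.⋂[]-lower (λ c → ∅ ⊆? f c) (hasEmpty X) (⊆-min (f ∅))) (⊆-min (pull ∅))

  -- If i ∈ f ∅ then pull ⁅ i ⁆ ⊆ ∅, so i ∈ f c for every codeword c, also for a preimage of ∅.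
  f-∅ : f ∅ ≡ ∅
  f-∅ = ⊆-antisym f∅⊆∅ (⊆-min (f ∅))
    where
    f∅⊆∅ : f ∅ ⊆ ∅
    f∅⊆∅ {i} i∈f∅ with f-surjective ∅ (hasEmpty Y)
    ... | c , mc , fc≡∅ = subst (i ∈_) fc≡∅ (Equivalence.from (⊆f⇔pull-⊆ b mc)
                            (⊆-trans (Equivalence.to (⊆f⇔pull-⊆ b (hasEmpty X)) ⁅i⁆⊆f∅) (⊆-min c)) (x∈⁅x⁆ i))
      where
      ⁅i⁆⊆f∅ : ⁅ i ⁆ ⊆ f ∅
      ⁅i⁆⊆f∅ j∈⁅i⁆ = subst (_∈ f ∅) (sym (x∈⁅y⁆⇒x≡y i j∈⁅i⁆)) i∈f∅
      b : CY.Bounded ⁅ i ⁆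
      b = f ∅ , proj₁ f-morphism ∅ (hasEmpty X) , ⁅i⁆⊆f∅

  open InjectionOn CY.hat? CX.hat? pull (λ hσ → pull∈hat (proj₁ (CY.hat⁻ hσ))) pull-injective public

  rank-≤ : rank Y Y? ≤ rank X X?
  rank-≤ = size-≤

  pull-bounded-hit : ∀ {τ} → CY.Bounded τ → Hit (pull τ)
  pull-bounded-hit {τ} bτ@(d , md , τ⊆d) =
    CY.cl τ , CY.⋂[]∈hat (τ ⊆?_) md τ⊆d , CX.Tk≡Tk⇒≡ (pull∈hat bclτ) (pull∈hat bτ) Tk
    where
    bclτ : CY.Bounded (CY.cl τ)
    bclτ = d , md , CY.cl-⊆ md τ⊆d
    Tk : ∀ {c} → mem X c → pull (CY.cl τ) ⊆ c ⇔ pull τ ⊆ c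
    Tk {c} mc = begin
      pull (CY.cl τ) ⊆ c ≈⟨ ⊆f⇔pull-⊆ bclτ mc ⟨
      CY.cl τ ⊆ f c      ≈⟨ CY.⊆⇔cl-⊆ (proj₁ f-morphism c mc) ⟨
      τ ⊆ f c            ≈⟨ ⊆f⇔pull-⊆ bτ mc ⟩
      pull τ ⊆ c         ∎
      where open SetoidReasoning (⇔-setoid 0ℓ)

  module _ (rank-X≤rank-Y : rank X X? ≤ rank Y Y?) where

    pull-onto : ∀ {t} → mem (hat X) t → Hit t
    pull-onto = size-≥⇒onto rank-X≤rank-Y

    f-injective : mem X c → mem X c′ → f c ≡ f c′ → c ≡ c′
    f-injective mc mc′ fc≡fc′ = ⊆-antisym (injective-⊆ mc mc′ fc≡fc′) (injective-⊆ mc′ mc (sym fc≡fc′))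
      where
      injective-⊆ : ∀ {c c′} → mem X c → mem X c′ → f c ≡ f c′ → c ⊆ c′
      injective-⊆ mc mc′ fc≡fc′ with pull-onto (CX.codeword∈hat mc)
      ... | σ , hσ , refl = Equivalence.to (⊆f⇔pull-⊆ bσ mc′)
                              (subst (σ ⊆_) fc≡fc′ (Equivalence.from (⊆f⇔pull-⊆ bσ mc) ⊆-refl))
        where bσ = proj₁ (CY.hat⁻ hσ)

    section : Map Y X
    section d with anySubset? (λ c → X? c ×-dec (f c ≟ d))
    ... | yes (c , _) = c
    ... | no _        = ∅

    section-spec : ∀ {d} → mem Y d → mem X (section d) × f (section d) ≡ d
    section-spec {d} md with anySubset? (λ c → X? c ×-dec (f c ≟ d))
    ... | yes (_ , spec) = spec
    ... | no ∄           = contradiction (f-surjective d md) ∄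

    section∘f : mem X c → section (f c) ≡ c
    section∘f mc = let msfc , fsfc≡fc = section-spec (proj₁ f-morphism _ mc) in f-injective msfc mc fsfc≡fc

    section-morphism : IsMorphism Y X section
    section-morphism = (λ _ md → proj₁ (section-spec md)) , preimage
      where
      preimage : (S : Subset (n X) → Set) → IsProperTrunk X S → IsProperTrunk Y (λ d → S (section d))
      preimage S ((τ , S⇔τ⊆) , (c₀ , mc₀ , Sc₀) , ¬all)
        with pull-onto (CX.⋂[]∈hat (τ ⊆?_) mc₀ (Equivalence.to (S⇔τ⊆ c₀ mc₀) Sc₀))
      ... | σ , hσ , pullσ≡clτ =
        (σ , Tk) ,
        (f c₀ , proj₁ f-morphism c₀ mc₀ , subst S (sym (section∘f mc₀)) Sc₀) ,
        (λ all → ¬all (λ c mc → subst S (section∘f mc) (all (f c) (proj₁ f-morphism c mc))))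
        where
        Tk : ∀ d → mem Y d → S (section d) ⇔ σ ⊆ d
        Tk d md with section-spec md
        ... | msd , fsd≡d = begin
          S (section d)       ≈⟨ S⇔τ⊆ _ msd ⟩
          τ ⊆ section d       ≈⟨ CX.⊆⇔cl-⊆ msd ⟩
          CX.cl τ ⊆ section d ≡⟨ cong (_⊆ section d) (sym pullσ≡clτ) ⟩
          pull σ ⊆ section d  ≈⟨ ⊆f⇔pull-⊆ (proj₁ (CY.hat⁻ hσ)) msd ⟨
          σ ⊆ f (section d)   ≡⟨ cong (σ ⊆_) fsd≡d ⟩
          σ ⊆ d               ∎
          where open SetoidReasoning (⇔-setoid 0ℓ)

    iso : Iso Y X
    iso = section , f , section-morphism , f-morphism , (λ _ md → proj₂ (section-spec md)) , (λ _ → section∘f)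

∪-⊆⇔ : ∀ {k} {p q r : Subset k} → p ∪ q ⊆ r ⇔ (p ⊆ r × q ⊆ r)
∪-⊆⇔ {p = p} {q} {r} = mk⇔ split join
  where
  split : p ∪ q ⊆ r → p ⊆ r × q ⊆ r
  split p∪q⊆r = (λ x∈p → p∪q⊆r (p⊆p∪q q x∈p)) , (λ x∈q → p∪q⊆r (q⊆p∪q p q x∈q))
  join : p ⊆ r × q ⊆ r → p ∪ q ⊆ r
  join (p⊆r , q⊆r) x∈p∪q = [ p⊆r , q⊆r ]′ (x∈p∪q⁻ p q x∈p∪q)

iso⇒≥C : ∀ {X Y} → Iso Y X → X ≤C Y
iso⇒≥C (g , h , g-morphism , h-morphism , _ , g∘h≡id) =
  g , g-morphism , λ x mx → h x , proj₁ h-morphism x mx , g∘h≡id x mx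

≤C⇒rank-≤ : ∀ {X Y} (X? : Decidable (mem X)) (Y? : Decidable (mem Y)) → Y ≤C X → rank Y Y? ≤ rank X X?
≤C⇒rank-≤ {X} {Y} X? Y? (_ , f-morphism , f-surjective) = Pullback.rank-≤ X Y X? Y? f-morphism f-surjective

<C⇒rank-< : ∀ {X Y} (X? : Decidable (mem X)) (Y? : Decidable (mem Y)) → Y <C X → rank Y Y? < rank X X?
<C⇒rank-< {X} {Y} X? Y? (Y≤X@(_ , f-morphism , f-surjective) , ¬iso) = ≤∧≢⇒< (≤C⇒rank-≤ X? Y? Y≤X)
  (λ rankY≡rankX → ¬iso (Pullback.iso X Y X? Y? f-morphism f-surjective (≤-reflexive (sym rankY≡rankX))))

rank-<⇒<C : ∀ {X Y} (X? : Decidable (mem X)) (Y? : Decidable (mem Y)) → Y ≤C X → rank Y Y? < rank X X? → Y <C X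
rank-<⇒<C {X} {Y} X? Y? Y≤X rankY<rankX = Y≤X , λ iso → <⇒≱ rankY<rankX (≤C⇒rank-≤ Y? X? (iso⇒≥C {X} {Y} iso))

when : ∀ {k} → Bool → Subset k → Subset k
when true  t = t
when false _ = ∅

module Refinement (X Y : Code) (X? : Decidable (mem X)) (Y? : Decidable (mem Y))
  {f : Map X Y} (f-morphism : IsMorphism X Y f) (f-surjective : IsSurjective X Y f) where

  open Pullback X Y X? Y? f-morphism f-surjective

  -- The trunk Tk_E(true ∷ ∅) pulls back to Tk_X(t), which is not pulled back from Y; every other
  -- trunk of E pulls back to some Tk_X(pull τ) or Tk_X(t ∪ pull τ), and maximality of t rules out t′.
  module _ {t t′ : Subset (n X)} (t-missed : Missed t) (t-maximal : ∀ {u} → Missed u → t ⊆ u → u ≡ t)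
           (t′-missed : Missed t′) (t′≢t : t′ ≢ t) where

    ψ : Subset (n X) → Subset (suc (n Y))
    ψ c = does (t ⊆? c) ∷ f c

    ∷⊆ψ⇔ : ∀ {s p c} → s ∷ p ⊆ ψ c ⇔ (when s t ⊆ c × p ⊆ f c)
    ∷⊆ψ⇔ {false} {p} {c} = mk⇔ {A = false ∷ p ⊆ ψ c} {B = ∅ ⊆ c × p ⊆ f c}
      (λ h → ⊆-min c , drop-∷-⊆ h) (λ (_ , p⊆fc) → out⊆ p⊆fc)
    ∷⊆ψ⇔ {true}  {p} {c} with t ⊆? c
    ... | yes t⊆c = mk⇔ {A = true ∷ p ⊆ true ∷ f c} {B = t ⊆ c × p ⊆ f c}
      (λ h → t⊆c , drop-∷-⊆ h) (λ (_ , p⊆fc) → in⊆in p⊆fc)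
    ... | no  t⊈c = mk⇔ {A = true ∷ p ⊆ false ∷ f c} {B = t ⊆ c × p ⊆ f c}
      (λ h → contradiction (h here) λ ()) (λ (t⊆c , _) → ⊥-elim (t⊈c t⊆c))

    ψ-∅ : ψ ∅ ≡ ∅
    ψ-∅ with t ⊆? ∅
    ... | yes t⊆∅ = contradiction (∅ , CY.codeword∈hat (hasEmpty Y) , trans pull-∅ (⊆-antisym (⊆-min t) t⊆∅))
                                  (proj₂ t-missed)
    ... | no _    = cong (false ∷_) f-∅

    E : Code
    E = record { n = suc (n Y) ; mem = λ e → ∃[ c ] mem X c × ψ c ≡ e ; hasEmpty = ∅ , hasEmpty X , ψ-∅ }

    E? : Decidable (mem E)
    E? e = anySubset? (λ c → X? c ×-dec (ψ c ≟ e))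

    χ-morphism : IsMorphism E Y tail
    χ-morphism = (λ { _ (c , mc , refl) → proj₁ f-morphism c mc }) , preimage
      where
      preimage : (S : Subset (n Y) → Set) → IsProperTrunk Y S → IsProperTrunk E (λ e → S (tail e))
      preimage S ((τ , S⇔τ⊆) , (d₀ , md₀ , Sd₀) , ¬all) =
        (false ∷ τ , λ { _ (c , mc , refl) → Tk mc }) , nonempty (f-surjective d₀ md₀) , not-all
        where
        Tk : ∀ {c} → mem X c → S (f c) ⇔ false ∷ τ ⊆ ψ c
        Tk {c} mc = begin
          S (f c)                 ≈⟨ S⇔τ⊆ (f c) (proj₁ f-morphism c mc) ⟩
          τ ⊆ f c                 ≈⟨ out⊆-⇔ ⟩
          false ∷ τ ⊆ ψ c         ∎
          where open SetoidReasoning (⇔-setoid 0ℓ)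
        nonempty : ∃[ c ] mem X c × f c ≡ d₀ → ∃[ e ] mem E e × S (tail e)
        nonempty (c , mc , refl) = ψ c , (c , mc , refl) , Sd₀
        not-all : ¬ (∀ e → mem E e → S (tail e))
        not-all all = ¬all λ d md → let c , mc , fc≡d = f-surjective d md in
                                     subst S fc≡d (all (ψ c) (c , mc , refl))

    χ-surjective : IsSurjective E Y tail
    χ-surjective d md = let c , mc , fc≡d = f-surjective d md in ψ c , (c , mc , refl) , fc≡d

    ψ-morphism : IsMorphism X E ψ
    ψ-morphism = (λ c mc → c , mc , refl) , preimage
      where
      preimage : (S : Subset (suc (n Y)) → Set) → IsProperTrunk E S → IsProperTrunk X (λ c → S (ψ c))
      preimage S ((s ∷ τ , S⇔τ⊆) , (_ , (c₀ , mc₀ , refl) , Sψc₀) , ¬all) =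
        (when s t ∪ pull τ , λ _ → Tk) , (c₀ , mc₀ , Sψc₀) , λ all → ¬all λ { _ (c , mc , refl) → all c mc }
        where
        bτ : CY.Bounded τ
        bτ = f c₀ , proj₁ f-morphism c₀ mc₀ ,
             proj₂ (Equivalence.to ∷⊆ψ⇔ (Equivalence.to (S⇔τ⊆ (ψ c₀) (c₀ , mc₀ , refl)) Sψc₀))
        Tk : ∀ {c} → mem X c → S (ψ c) ⇔ when s t ∪ pull τ ⊆ c
        Tk {c} mc = begin
          S (ψ c)                      ≈⟨ S⇔τ⊆ (ψ c) (c , mc , refl) ⟩
          s ∷ τ ⊆ ψ c                  ≈⟨ ∷⊆ψ⇔ ⟩
          (when s t ⊆ c × τ ⊆ f c)     ≈⟨ ⇔-id _ ×-⇔ ⊆f⇔pull-⊆ bτ mc ⟩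
          (when s t ⊆ c × pull τ ⊆ c)  ≈⟨ ∪-⊆⇔ ⟨
          when s t ∪ pull τ ⊆ c        ∎
          where open SetoidReasoning (⇔-setoid 0ℓ)

    ψ-surjective : IsSurjective X E ψ
    ψ-surjective _ mψc = mψc

    module CE = Closure E E?
    module χ = Pullback E Y E? Y? χ-morphism χ-surjective
    module ψ = Pullback X E X? E? ψ-morphism ψ-surjective

    rank-Y<rank-E : rank Y Y? < rank E E?
    rank-Y<rank-E with proj₁ (CX.hat⁻ (proj₁ t-missed))
    ... | c₀ , mc₀ , t⊆c₀ =
      χ.missed⇒size-< (CE.⋂[]∈hat (e ⊆?_) (c₀ , mc₀ , refl) (Equivalence.from ∷⊆ψ⇔ (t⊆c₀ , ⊆-min (f c₀))) ,
                        cl-e-missed)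
      where
      e : Subset (suc (n Y))
      e = true ∷ ∅
      cl-e-missed : ¬ χ.Hit (CE.cl e)
      cl-e-missed (σ , hσ , pullσ≡cle) = proj₂ t-missed (σ , hσ , CX.Tk≡Tk⇒≡ (pull∈hat bσ) (proj₁ t-missed) Tk)
        where
        bσ = proj₁ (CY.hat⁻ hσ)
        Tk : ∀ {c} → mem X c → pull σ ⊆ c ⇔ t ⊆ c
        Tk {c} mc = begin
          pull σ ⊆ c            ≈⟨ ⊆f⇔pull-⊆ bσ mc ⟨
          σ ⊆ f c               ≈⟨ χ.⊆f⇔pull-⊆ bσ (c , mc , refl) ⟩
          χ.pull σ ⊆ ψ c        ≡⟨ cong (_⊆ ψ c) pullσ≡cle ⟩
          CE.cl e ⊆ ψ c         ≈⟨ CE.⊆⇔cl-⊆ (c , mc , refl) ⟨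
          e ⊆ ψ c               ≈⟨ ∷⊆ψ⇔ ⟩
          (t ⊆ c × ∅ ⊆ f c)     ≈⟨ mk⇔ {A = t ⊆ c × ∅ ⊆ f c} proj₁ (λ t⊆c → t⊆c , ⊆-min (f c)) ⟩
          t ⊆ c                 ∎
          where open SetoidReasoning (⇔-setoid 0ℓ)

    rank-E<rank-X : rank E E? < rank X X?
    rank-E<rank-X = ψ.missed⇒size-< (proj₁ t′-missed , t′-missed-by-ψ)
      where
      Tk-t′ : ∀ {s τ} → mem (hat E) (s ∷ τ) → ψ.pull (s ∷ τ) ≡ t′ →
              CY.Bounded τ × (∀ {c} → mem X c → t′ ⊆ c ⇔ (when s t ⊆ c × pull τ ⊆ c))
      Tk-t′ {s} {τ} he pullψe≡t′ with proj₁ (CE.hat⁻ he)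
      ... | _ , (c₁ , mc₁ , refl) , e⊆ψc₁ = bτ , Tk
        where
        bτ : CY.Bounded τ
        bτ = f c₁ , proj₁ f-morphism c₁ mc₁ , proj₂ (Equivalence.to ∷⊆ψ⇔ e⊆ψc₁)
        Tk : ∀ {c} → mem X c → t′ ⊆ c ⇔ (when s t ⊆ c × pull τ ⊆ c)
        Tk {c} mc = begin
          t′ ⊆ c                        ≡⟨ cong (_⊆ c) pullψe≡t′ ⟨
          ψ.pull (s ∷ τ) ⊆ c            ≈⟨ ψ.⊆f⇔pull-⊆ (proj₁ (CE.hat⁻ he)) mc ⟨
          s ∷ τ ⊆ ψ c                   ≈⟨ ∷⊆ψ⇔ ⟩
          (when s t ⊆ c × τ ⊆ f c)      ≈⟨ ⇔-id _ ×-⇔ ⊆f⇔pull-⊆ bτ mc ⟩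
          (when s t ⊆ c × pull τ ⊆ c)   ∎
          where open SetoidReasoning (⇔-setoid 0ℓ)

      t′-missed-by-ψ : ¬ ψ.Hit t′
      t′-missed-by-ψ (false ∷ τ , he , pullψe≡t′) =
        proj₂ t′-missed (subst Hit (sym t′≡pullτ) (pull-bounded-hit bτ))
        where
        bτ = proj₁ (Tk-t′ he pullψe≡t′)
        t′≡pullτ : t′ ≡ pull τ
        t′≡pullτ = CX.Tk≡Tk⇒≡ (proj₁ t′-missed) (pull∈hat bτ)
          (λ {c} mc → mk⇔ {A = ∅ ⊆ c × pull τ ⊆ c} proj₂ (λ pullτ⊆c → ⊆-min c , pullτ⊆c) ⇔-∘ proj₂ (Tk-t′ he pullψe≡t′) mc)
      t′-missed-by-ψ (true ∷ τ , he , pullψe≡t′) = t′≢t (t-maximal t′-missed (CX.Tk⊆Tk⇒⊇ (proj₁ t′-missed)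
        (λ mc t′⊆c → proj₁ (Equivalence.to (proj₂ (Tk-t′ he pullψe≡t′) mc) t′⊆c))))

    between : (Y <C E) × (E <C X)
    between = rank-<⇒<C E? Y? (tail , χ-morphism , χ-surjective) rank-Y<rank-E ,
              rank-<⇒<C X? E? (ψ , ψ-morphism , ψ-surjective) rank-E<rank-X

gap⇒intermediate : ∀ {X Y} (X? : Decidable (mem X)) (Y? : Decidable (mem Y)) → Y ≤C X →
                   2 + rank Y Y? ≤ rank X X? → ∃[ E ] (Y <C E) × (E <C X)
gap⇒intermediate {X} {Y} X? Y? (_ , f-morphism , f-surjective) gap =
  let t₀ , t₀-missed , _         = two-more⇒missed-besides gap ∅
      t  , t-missed  , t-maximal = maximal missed? t₀-missed
      t′ , t′-missed , t′≢t      = two-more⇒missed-besides gap t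
  in E t-missed t-maximal t′-missed t′≢t , between t-missed t-maximal t′-missed t′≢t
  where
  open Pullback X Y X? Y? f-morphism f-surjective
  open Refinement X Y X? Y? f-morphism f-surjective

covers⇔rank-suc : ∀ {X Y} (X? : Decidable (mem X)) (Y? : Decidable (mem Y)) → Y ≤C X →
                  Covers X Y ⇔ rank X X? ≡ suc (rank Y Y?)
covers⇔rank-suc {X} {Y} X? Y? Y≤X = mk⇔ covers⇒rank-suc rank-suc⇒covers
  where
  covers⇒rank-suc : Covers X Y → rank X X? ≡ suc (rank Y Y?)
  covers⇒rank-suc (Y<X , nothing-between) with rank X X? ≤? suc (rank Y Y?)
  ... | yes rankX≤1+rankY = ≤-antisym rankX≤1+rankY (<C⇒rank-< X? Y? Y<X)
  ... | no  rankX≰1+rankY =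
    let E , Y<E<X = gap⇒intermediate X? Y? Y≤X (≰⇒> rankX≰1+rankY) in ⊥-elim (nothing-between E Y<E<X)
  rank-suc⇒covers : rank X X? ≡ suc (rank Y Y?) → Covers X Y
  rank-suc⇒covers rankX≡1+rankY = rank-<⇒<C X? Y? Y≤X (≤-reflexive (sym rankX≡1+rankY)) ,
    λ E (Y<E , E<X) → ¬¬-decidable (mem E) λ E? →
      <⇒≱ (<C⇒rank-< E? Y? Y<E) (≤-pred (subst (rank E E? <_) rankX≡1+rankY (<C⇒rank-< X? E? E<X)))

covers-hat⇔covers : ∀ {C D} (C? : Decidable (mem C)) (D? : Decidable (mem D)) → D ≤C C → hat D ≤C hat C →
                    Covers (hat C) (hat D) ⇔ Covers C D
covers-hat⇔covers {C} {D} C? D? D≤C D̂≤Ĉ = begin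
  Covers (hat C) (hat D)                ∼⟨ covers⇔rank-suc Ĉ? D̂? D̂≤Ĉ ⟩
  rank (hat C) Ĉ? ≡ suc (rank (hat D) D̂?) ≡⟨ cong₂ (λ a b → a ≡ suc b) (rank-hat C?) (rank-hat D?) ⟩
  rank C C? ≡ suc (rank D D?)           ∼⟨ ⇔-sym (covers⇔rank-suc C? D? D≤C) ⟩
  Covers C D                            ∎
  where
  open EquationalReasoning
  Ĉ? = Closure.hat? C C?
  D̂? = Closure.hat? D D?

covers-stable : ∀ {X Y} → Y ≤C X → ¬ ¬ Covers X Y → Covers X Y
covers-stable Y≤X ¬¬covers =
  (Y≤X , λ iso → ¬¬covers λ ((_ , ¬iso) , _) → ¬iso iso) ,
  λ E between → ¬¬covers λ (_ , nothing-between) → nothing-between E between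

lemma14 : (C D : Code) (f : Map C D) → IsMorphism C D f → IsSurjective C D f →
          (g : Map (hat C) (hat D)) → IsMorphism (hat C) (hat D) g →
          IsSurjective (hat C) (hat D) g → (∀ c → mem C c → g c ≡ f c) →
          (Covers (hat C) (hat D) ⇔ Covers C D)
lemma14 C D f f-morphism f-surjective g g-morphism g-surjective _ =
  mk⇔ (λ covers → covers-stable {C} {D} D≤C (¬¬-map (flip Equivalence.to covers) ¬¬covers-hat⇔covers))
      (λ covers → covers-stable {hat C} {hat D} D̂≤Ĉ (¬¬-map (flip Equivalence.from covers) ¬¬covers-hat⇔covers))
  where
  D≤C : D ≤C C
  D≤C = f , f-morphism , f-surjective
  D̂≤Ĉ : hat D ≤C hat C
  D̂≤Ĉ = g , g-morphism , g-surjective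
  ¬¬covers-hat⇔covers : ¬ ¬ (Covers (hat C) (hat D) ⇔ Covers C D)
  ¬¬covers-hat⇔covers k = ¬¬-decidable (mem C) λ C? → ¬¬-decidable (mem D) λ D? →
                            k (covers-hat⇔covers {C} {D} C? D? D≤C D̂≤Ĉ)
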